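{- For every integer $k\geq 2$ there exists a finite magical graph $G$ such that $\omega(G)=k$ and $\chi(G)=\binom{k+1}{2}$.
   Context: A double-ordered graph $G_{<_1,<_2}$ is a graph with two total orders $<_1,<_2$ on its vertex set; it is magical if for any three distinct vertices $a<_1 b<_1 c$ with $ab,bc\in E(G)$ and $ac\notin E(G)$ we have $b<_2 a$ and $b<_2 c$. A graph $G$ is magical if there exist total orders $<_1,<_2$ on $V(G)$ such that $G_{<_1,<_2}$ is magical. $\omega$ and $\chi$ denote clique number and chromatic number. -}

module Defs where

open import Level using (0ℓ)
open import Data.Nat using (ℕ; suc)
open import Data.Fin using (Fin)
open import Data.Product using (Σ; _×_; ∃-syntax)
open import Relation.Nullary using (¬_)
open import Relation.Binary.PropositionalEquality using (_≡_)
open import Relation.Binary.Core using (Rel)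
open import Relation.Binary.Structures using (IsStrictTotalOrder)
open import Function.Definitions using (Injective)

record Graph : Set₁ where
  field
    n    : ℕ
    Adj  : Rel (Fin n) 0ℓ
    sym  : ∀ {u v} → Adj u v → Adj v u
    irr  : ∀ {v} → ¬ Adj v v
open Graph public

TotalOrder : Graph → Set₁
TotalOrder G = Σ (Rel (Fin (n G)) 0ℓ) λ _<_ → IsStrictTotalOrder _≡_ _<_

IsMagicalWith : (G : Graph) → Rel (Fin (n G)) 0ℓ → Rel (Fin (n G)) 0ℓ → Set
IsMagicalWith G _<₁_ _<₂_ =
  ∀ a b c → a <₁ b → b <₁ c → Adj G a b → Adj G b c → ¬ Adj G a c →
  (b <₂ a) × (b <₂ c)

Magical : Graph → Set₁
Magical G = Σ (TotalOrder G) λ o₁ → Σ (TotalOrder G) λ o₂ →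
  IsMagicalWith G (Data.Product.proj₁ o₁) (Data.Product.proj₁ o₂)
  where import Data.Product

HasClique : (G : Graph) → ℕ → Set
HasClique G m = Σ (Fin m → Fin (n G)) λ f →
  Injective _≡_ _≡_ f × (∀ i j → ¬ i ≡ j → Adj G (f i) (f j))

CliqueNumber : Graph → ℕ → Set
CliqueNumber G k = HasClique G k × ¬ HasClique G (suc k)

Colourable : Graph → ℕ → Set
Colourable G c = Σ (Fin (n G) → Fin c) λ col →
  ∀ u v → Adj G u v → ¬ col u ≡ col v

ChromaticNumber : Graph → ℕ → Set
ChromaticNumber G c = Colourable G c × (∀ d → Colourable G d → c Data.Nat.≤ d)
  where import Data.Nat

module Submission where

-- The graphs are built by induction on the clique number.  K₁ has ω = χ = 1.
-- Given a magical H with ω(H) = k+1 and χ(H) = c, the step builds G as follows.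
-- Put s = k+2, D = s + (c-1), P = D^|H| and take M = (k+1)·P + 1 disjoint copies
-- of H.  For every s-tuple γ of copy indices add an s-clique (a "gadget") whose
-- j-th vertex is joined to the whole copy γ(j) when position j is the only
-- position of γ holding that index.  Then
--   * ω(G) = s: a clique meeting a copy can contain at most one gadget vertex,
--     so it is an H-clique plus one vertex;
--   * χ(G) ≤ c + s: colour the copies like H and the gadget positions freshly;
--   * χ(G) ≥ c + s: a colouring with D colours gives every copy one of P
--     colour patterns, so by the generalised pigeonhole principle s copies
--     share a pattern; the gadget on these copies uses s colours that the
--     common pattern avoids, which leaves an H-colouring with c - 1 colours;
--   * G is magical: order copies before gadgets (and gadgets before copies
--     in the second order), lexicographically inside each part.
-- Since c + s = (k+2 choose 2) + (k+2) = (k+3 choose 2), induction gives the theorem.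

open import Defs hiding (sym; irr)
open import Level using (0ℓ)
open import Data.Nat using (ℕ; zero; suc; _+_; _*_; _^_; _≤_; _<_; s≤s; z≤n; _≤?_)
open import Data.Nat.Properties
  using (1+n≰n; n≮0; n<1+n; ≤-pred; ≰⇒>; +-suc; +-comm; *-suc; +-cancelˡ-<; +-monoˡ-≤; <-≤-trans)
open import Data.Nat.Combinatorics using (_C_; nCk+nC[k+1]≡[n+1]C[k+1]; nC1≡n)
open import Data.Fin as Fin
  using (Fin; zero; suc; punchIn; punchOut; inject≤; lift; join; splitAt; finToFun; funToFin)
open import Data.Fin.Properties as FinP
  using (¬Fin0; any?; _≟_; injective⇒≤; punchIn-injective; punchOut-injective; inject≤-injective
        ; lift-injective; splitAt-join; finToFun-funToFin; +↔⊎; *↔×; suc-injective)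
open import Data.Product using (Σ; _×_; _,_; proj₁; proj₂)
open import Data.Product.Relation.Binary.Lex.Strict using (×-Lex; ×-isStrictTotalOrder)
open import Data.Product.Relation.Binary.Pointwise.NonDependent using (≡×≡⇒≡)
open import Data.Sum using (_⊎_; inj₁; inj₂; swap)
open import Data.Sum.Properties using (swap-involutive; inj₁-injective; inj₂-injective)
open import Data.Sum.Function.Propositional using (_⊎-↔_)
open import Data.Sum.Relation.Binary.LeftOrder using (_⊎-<_; ₁∼₂; ₁∼₁; ₂∼₂; ⊎-<-isStrictTotalOrder)
open import Data.Sum.Relation.Binary.Pointwise using (Pointwise-≡⇒≡)
open import Data.Unit using (⊤; tt)
open import Data.Empty using (⊥; ⊥-elim)
open import Function using (_on_; flip; _∘_)
open import Function.Bundles using (_↔_; Inverse)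
open import Function.Definitions using (Injective)
open import Function.Properties.Inverse using (↔-trans)
open import Relation.Nullary using (¬_; yes; no; ¬?)
open import Relation.Nullary.Decidable using (decidable-stable)
open import Relation.Unary using (Decidable)
open import Relation.Binary.Core using (Rel)
open import Relation.Binary.Structures using (IsStrictTotalOrder)
open import Relation.Binary.Definitions using (Trichotomous; Irreflexive; tri<; tri≈; tri>)
open import Relation.Binary.PropositionalEquality
import Relation.Binary.Construct.On as On
import Relation.Binary.Construct.Flip.Ord as Flip

≡-isStrictTotalOrder : {A : Set} {_≈_ _<_ : Rel A 0ℓ} → (∀ {x y} → x ≈ y → x ≡ y) →
                       IsStrictTotalOrder _≈_ _<_ → IsStrictTotalOrder _≡_ _<_
≡-isStrictTotalOrder {_<_ = _<_} ≈⇒≡ sto = record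
  { isStrictPartialOrder = record
    { isEquivalence = isEquivalence
    ; irrefl        = λ { refl → S.irrefl S.Eq.refl }
    ; trans         = S.trans
    ; <-resp-≈      = (λ { refl r → r }) , (λ { refl r → r })
    }
  ; compare = compare
  }
  where
  module S = IsStrictTotalOrder sto
  compare : Trichotomous _≡_ _<_
  compare x y with S.compare x y
  ... | tri< l ¬e ¬g = tri< l (¬e ∘ S.Eq.reflexive) ¬g
  ... | tri≈ ¬l e ¬g = tri≈ ¬l (≈⇒≡ e) ¬g
  ... | tri> ¬l ¬e g = tri> ¬l (¬e ∘ S.Eq.reflexive) g

Lex : {A B : Set} → Rel A 0ℓ → Rel B 0ℓ → Rel (A × B) 0ℓ
Lex _<₁_ _<₂_ = ×-Lex _≡_ _<₁_ _<₂_

lex-isSTO : {A B : Set} {_<₁_ : Rel A 0ℓ} {_<₂_ : Rel B 0ℓ} →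
            IsStrictTotalOrder _≡_ _<₁_ → IsStrictTotalOrder _≡_ _<₂_ →
            IsStrictTotalOrder _≡_ (Lex _<₁_ _<₂_)
lex-isSTO s₁ s₂ = ≡-isStrictTotalOrder ≡×≡⇒≡ (×-isStrictTotalOrder s₁ s₂)

lex-tie : {A B : Set} {_<₁_ : Rel A 0ℓ} {_<₂_ : Rel B 0ℓ} → Irreflexive _≡_ _<₁_ →
          ∀ {a x y} → Lex _<₁_ _<₂_ (a , x) (a , y) → x <₂ y
lex-tie irr (inj₁ a<a)     = ⊥-elim (irr refl a<a)
lex-tie irr (inj₂ (_ , r)) = r

sum-isSTO : {A B : Set} {_<₁_ : Rel A 0ℓ} {_<₂_ : Rel B 0ℓ} →
            IsStrictTotalOrder _≡_ _<₁_ → IsStrictTotalOrder _≡_ _<₂_ →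
            IsStrictTotalOrder _≡_ (_<₁_ ⊎-< _<₂_)
sum-isSTO s₁ s₂ = ≡-isStrictTotalOrder Pointwise-≡⇒≡ (⊎-<-isStrictTotalOrder s₁ s₂)

flip-isSTO : {A : Set} {_<_ : Rel A 0ℓ} →
             IsStrictTotalOrder _≡_ _<_ → IsStrictTotalOrder _≡_ (flip _<_)
flip-isSTO s = ≡-isStrictTotalOrder sym (Flip.isStrictTotalOrder s)

on-isSTO : {A B : Set} {_<_ : Rel B 0ℓ} (f : A → B) → Injective _≡_ _≡_ f →
           IsStrictTotalOrder _≡_ _<_ → IsStrictTotalOrder _≡_ (_<_ on f)
on-isSTO f f-inj s = ≡-isStrictTotalOrder f-inj (On.isStrictTotalOrder f s)

_⊎->_ : {A B : Set} → Rel A 0ℓ → Rel B 0ℓ → Rel (A ⊎ B) 0ℓ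
_<₁_ ⊎-> _<₂_ = (_<₂_ ⊎-< _<₁_) on swap

sum>-isSTO : {A B : Set} {_<₁_ : Rel A 0ℓ} {_<₂_ : Rel B 0ℓ} →
             IsStrictTotalOrder _≡_ _<₁_ → IsStrictTotalOrder _≡_ _<₂_ →
             IsStrictTotalOrder _≡_ (_<₁_ ⊎-> _<₂_)
sum>-isSTO s₁ s₂ = on-isSTO swap swap-injective (sum-isSTO s₂ s₁)
  where
  swap-injective : ∀ {x y} → swap x ≡ swap y → x ≡ y
  swap-injective {x} {y} e =
    trans (sym (swap-involutive x)) (trans (cong swap e) (swap-involutive y))

<-STO : ∀ {m} → IsStrictTotalOrder _≡_ (Fin._<_ {m})
<-STO = FinP.<-isStrictTotalOrder

>-STO : ∀ {m} → IsStrictTotalOrder _≡_ (flip (Fin._<_ {m}))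
>-STO = flip-isSTO <-STO

MagicalOrders : {V : Set} → Rel V 0ℓ → Rel V 0ℓ → Rel V 0ℓ → Set
MagicalOrders E _<₁_ _<₂_ =
  ∀ a b c → a <₁ b → b <₁ c → E a b → E b c → ¬ E a c → (b <₂ a) × (b <₂ c)

IsClique : {V : Set} → Rel V 0ℓ → {m : ℕ} → (Fin m → V) → Set
IsClique E f = ∀ i j → i ≢ j → E (f i) (f j)

IsProperColouring : {V : Set} → Rel V 0ℓ → {c : ℕ} → (V → Fin c) → Set
IsProperColouring E col = ∀ u v → E u v → col u ≢ col v

separated⇒injective : ∀ {m} {B : Set} (f : Fin m → B) → (∀ i j → i ≢ j → f i ≢ f j) →
                      Injective _≡_ _≡_ f
separated⇒injective f sep {i} {j} e = decidable-stable (i ≟ j) (λ i≢j → sep i j i≢j e)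

clique⇒injective : ∀ {V : Set} {E : Rel V 0ℓ} → (∀ {v} → ¬ E v v) →
                   ∀ {m} (f : Fin m → V) → IsClique E f → Injective _≡_ _≡_ f
clique⇒injective {E = E} irr f clique =
  separated⇒injective f λ i j i≢j e → irr (subst (E (f i)) (sym e) (clique i j i≢j))

module Relabel {V : Set} {N : ℕ} (label : Fin N ↔ V) (E : Rel V 0ℓ)
               (E-sym : ∀ {u v} → E u v → E v u) (E-irr : ∀ {v} → ¬ E v v) where

  open Inverse label using (to; from; strictlyInverseˡ; strictlyInverseʳ)

  graph : Graph
  graph = record { n = N ; Adj = E on to ; sym = E-sym ; irr = E-irr }

  to-injective : Injective _≡_ _≡_ to
  to-injective {x} {y} e = trans (sym (strictlyInverseʳ x)) (trans (cong from e) (strictlyInverseʳ y))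

  adj-from : ∀ {u v} → E u v → Adj graph (from u) (from v)
  adj-from {u} {v} = subst₂ E (sym (strictlyInverseˡ u)) (sym (strictlyInverseˡ v))

  magical : {_<₁_ _<₂_ : Rel V 0ℓ} →
            IsStrictTotalOrder _≡_ _<₁_ → IsStrictTotalOrder _≡_ _<₂_ →
            MagicalOrders E _<₁_ _<₂_ → Magical graph
  magical s₁ s₂ magic =
    (_ , on-isSTO to to-injective s₁) , (_ , on-isSTO to to-injective s₂) ,
    λ a b c → magic (to a) (to b) (to c)

  hasClique : ∀ {m} (f : Fin m → V) → IsClique E f → HasClique graph m
  hasClique f clique = from ∘ f , clique⇒injective {E = Adj graph} E-irr (from ∘ f) adj , adj
    where
    adj : IsClique (Adj graph) (from ∘ f)
    adj i j i≢j = adj-from (clique i j i≢j)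

  noClique : ∀ {m} → (∀ (f : Fin m → V) → IsClique E f → ⊥) → ¬ HasClique graph m
  noClique none (f , _ , clique) = none (to ∘ f) clique

  colourable : ∀ {c} (col : V → Fin c) → IsProperColouring E col → Colourable graph c
  colourable col proper = col ∘ to , λ u v → proper (to u) (to v)

  colouring : ∀ {c} → Colourable graph c → Σ (V → Fin c) (IsProperColouring E)
  colouring (col , proper) = col ∘ from , λ u v a → proper (from u) (from v) (adj-from a)

record Partition {m : ℕ} (Q : Fin m → Set) : Set where
  field
    #in #out     : ℕ
    size         : #in + #out ≡ m
    inside       : Fin #in → Fin m
    outside      : Fin #out → Fin m
    inside-inj   : Injective _≡_ _≡_ inside
    outside-inj  : Injective _≡_ _≡_ outside
    inside-sat   : ∀ i → Q (inside i)
    outside-sat  : ∀ i → ¬ Q (outside i)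

partition : ∀ {m} (Q : Fin m → Set) → Decidable Q → Partition Q
partition {zero} Q Q? = record
  { #in = 0 ; #out = 0 ; size = refl ; inside = λ () ; outside = λ ()
  ; inside-inj = λ { {()} } ; outside-inj = λ { {()} }
  ; inside-sat = λ () ; outside-sat = λ () }
partition {suc m} Q Q? with Q? zero
... | yes q = record
  { #in = suc #in ; #out = #out ; size = cong suc size
  ; inside = lift 1 inside ; outside = suc ∘ outside
  ; inside-inj = lift-injective inside inside-inj 1 ; outside-inj = outside-inj ∘ suc-injective
  ; inside-sat = λ { zero → q ; (suc i) → inside-sat i } ; outside-sat = outside-sat }
  where open Partition (partition (Q ∘ suc) (Q? ∘ suc))
... | no ¬q = record
  { #in = #in ; #out = suc #out ; size = trans (+-suc #in #out) (cong suc size)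
  ; inside = suc ∘ inside ; outside = lift 1 outside
  ; inside-inj = inside-inj ∘ suc-injective ; outside-inj = lift-injective outside outside-inj 1
  ; inside-sat = inside-sat ; outside-sat = λ { zero → ¬q ; (suc i) → outside-sat i } }
  where open Partition (partition (Q ∘ suc) (Q? ∘ suc))

record Monochromatic {m P : ℕ} (f : Fin m → Fin P) (k : ℕ) : Set where
  field
    point     : Fin (suc k) → Fin m
    point-inj : Injective _≡_ _≡_ point
    same      : ∀ i → f (point i) ≡ f (point zero)

-- Induction on
-- P: either colour zero has k+1 points, or the other colours have more than
-- k·(P-1) points between them.
pigeonhole : ∀ k P {m} (f : Fin m → Fin P) → k * P < m → Monochromatic f k
pigeonhole k zero {zero}  f k*0<0 = ⊥-elim (n≮0 k*0<0)
pigeonhole k zero {suc m} f _     = ⊥-elim (¬Fin0 (f zero))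
pigeonhole k (suc P) {m} f k*P<m with partition (λ i → f i ≡ zero) (λ i → f i ≟ zero)
... | part with suc k ≤? Partition.#in part
...   | yes k<#in = record
  { point     = λ i → inside (inject≤ i k<#in)
  ; point-inj = inject≤-injective k<#in k<#in _ _ ∘ inside-inj
  ; same      = λ i → trans (inside-sat _) (sym (inside-sat _)) }
  where open Partition part
...   | no k≮#in = record
  { point     = outside ∘ g
  ; point-inj = g-inj ∘ outside-inj
  ; same      = λ i → punchOut-injective (nonzero (g i)) (nonzero (g zero)) (g-same i) }
  where
  open Partition part
  nonzero : ∀ j → zero ≢ f (outside j)
  nonzero j e = outside-sat j (sym e)
  f′ : Fin #out → Fin P
  f′ j = punchOut (nonzero j)
  k*P<#out : k * P < #out
  k*P<#out = +-cancelˡ-< k _ _ (<-≤-trans (subst (_< m) (*-suc k P) k*P<m)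
               (subst (_≤ k + #out) size (+-monoˡ-≤ #out (≤-pred (≰⇒> k≮#in)))))
  open Monochromatic (pigeonhole k P f′ k*P<#out)
    renaming (point to g; point-inj to g-inj; same to g-same)

compress : ∀ {X : Set} s t (h : X → Fin (s + t)) (c : Fin s → Fin (s + t)) →
           Injective _≡_ _≡_ c → (∀ x j → h x ≢ c j) →
           Σ (X → Fin t) λ h′ → ∀ x y → h′ x ≡ h′ y → h x ≡ h y
compress zero t h c _ _ = h , λ _ _ e → e
compress {X} (suc s) t h c c-inj avoid =
  proj₁ rec , λ x y e → punchOut-injective (h≢c₀ x) (h≢c₀ y) (proj₂ rec x y e)
  where
  h≢c₀ : ∀ x → c zero ≢ h x
  h≢c₀ x e = avoid x zero (sym e)
  c≢c₀ : ∀ j → c zero ≢ c (suc j)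
  c≢c₀ j e with c-inj e
  ... | ()
  h₁ : X → Fin (s + t)
  h₁ x = punchOut (h≢c₀ x)
  c₁ : Fin s → Fin (s + t)
  c₁ j = punchOut (c≢c₀ j)
  rec : Σ (X → Fin t) λ h′ → ∀ x y → h′ x ≡ h′ y → h₁ x ≡ h₁ y
  rec = compress s t h₁ c₁
          (λ e → suc-injective (c-inj (punchOut-injective (c≢c₀ _) (c≢c₀ _) e)))
          (λ x j e → avoid x (suc j) (punchOut-injective (h≢c₀ x) (c≢c₀ j) e))

module Step (H : Graph) (k t : ℕ) (magH : Magical H)
            (noCliqueH : ¬ HasClique H (suc (suc k)))
            (colH : Colourable H (suc t)) (lowH : ∀ d → Colourable H d → suc t ≤ d) where

  s D P M : ℕ
  s = suc (suc k)         -- the clique number of the new graph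
  D = s + t               -- a number of colours that will be shown insufficient
  P = D ^ n H             -- the number of D-colour patterns of H
  M = suc (suc k * P)     -- the number of copies of H

  -- s-tuples of copy indices, encoded as elements of Fin (M ^ s).
  Tuple : Set
  Tuple = Fin (M ^ s)

  V : Set
  V = (Fin M × Fin (n H)) ⊎ (Tuple × Fin s)

  pattern copy i x   = inj₁ (i , x)
  pattern gadget γ j = inj₂ (γ , j)

  SoleEntry : Tuple → Fin s → Fin M → Set
  SoleEntry γ j i = finToFun γ j ≡ i × (∀ j′ → finToFun γ j′ ≡ i → j′ ≡ j)

  E : Rel V 0ℓ
  E (copy i x)   (copy i′ x′)   = i ≡ i′ × Adj H x x′
  E (copy i x)   (gadget γ j)   = SoleEntry γ j i
  E (gadget γ j) (copy i x)     = SoleEntry γ j i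
  E (gadget γ j) (gadget γ′ j′) = γ ≡ γ′ × j ≢ j′

  E-sym : ∀ {u v} → E u v → E v u
  E-sym {copy _ _}   {copy _ _}   (e , a)   = sym e , Graph.sym H a
  E-sym {copy _ _}   {gadget _ _} a         = a
  E-sym {gadget _ _} {copy _ _}   a         = a
  E-sym {gadget _ _} {gadget _ _} (e , j≢j′) = sym e , j≢j′ ∘ sym

  E-irr : ∀ {v} → ¬ E v v
  E-irr {copy _ _}   (_ , a)   = Graph.irr H a
  E-irr {gadget _ _} (_ , j≢j) = j≢j refl

  _<ᴴ₁_ _<ᴴ₂_ : Rel (Fin (n H)) 0ℓ
  _<ᴴ₁_ = proj₁ (proj₁ magH)
  _<ᴴ₂_ = proj₁ (proj₁ (proj₂ magH))

  _<ᵍ_ : Rel (Tuple × Fin s) 0ℓ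
  _<ᵍ_ = Lex Fin._<_ (flip Fin._<_)

  _<₁_ _<₂_ : Rel V 0ℓ
  _<₁_ = Lex Fin._<_ _<ᴴ₁_ ⊎-< _<ᵍ_
  _<₂_ = Lex Fin._<_ _<ᴴ₂_ ⊎-> _<ᵍ_

  <₁-STO : IsStrictTotalOrder _≡_ _<₁_
  <₁-STO = sum-isSTO (lex-isSTO <-STO (proj₂ (proj₁ magH))) (lex-isSTO <-STO >-STO)

  <₂-STO : IsStrictTotalOrder _≡_ _<₂_
  <₂-STO = sum>-isSTO (lex-isSTO <-STO (proj₂ (proj₁ (proj₂ magH)))) (lex-isSTO <-STO >-STO)

  tie : ∀ {B : Set} (_<′_ : Rel B 0ℓ) {m} {a : Fin m} {x y} →
        Lex Fin._<_ _<′_ (a , x) (a , y) → x <′ y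
  tie _<′_ = lex-tie {_<₁_ = Fin._<_} {_<₂_ = _<′_} FinP.<-irrefl

  magic : MagicalOrders E _<₁_ _<₂_
  -- Three vertices of one copy: this is the magic of H.
  magic (copy i x) (copy .i y) (copy .i z) (₁∼₁ ab) (₁∼₁ bc) (refl , xy) (refl , yz) ¬ac =
    let (yx , yz′) = proj₂ (proj₂ magH) x y z (tie _<ᴴ₁_ ab) (tie _<ᴴ₁_ bc) xy yz (λ xz → ¬ac (refl , xz))
    in ₂∼₂ (inj₂ (refl , yx)) , ₂∼₂ (inj₂ (refl , yz′))
  -- A gadget vertex seeing a copy vertex sees its whole copy.
  magic (copy i x) (copy .i y) (gadget γ j) _ _ (refl , _) bc ¬ac = ⊥-elim (¬ac bc)
  -- A gadget vertex precedes copy vertices in <₂ and its own clique is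
  -- ordered alike in <₁ and <₂.
  magic (copy _ _) (gadget _ _) (gadget _ _) _ (₂∼₂ bc) _ _ _ = ₁∼₂ , ₁∼₁ bc
  -- Three vertices of one gadget are pairwise adjacent.
  magic (gadget γ j₁) (gadget .γ j₂) (gadget .γ j₃) (₂∼₂ ab) (₂∼₂ bc) (refl , _) (refl , _) ¬ac =
    ⊥-elim (¬ac (refl , λ j₁≡j₃ → FinP.<-irrefl (sym j₁≡j₃) (FinP.<-trans (tie (flip Fin._<_) bc) (tie (flip Fin._<_) ab))))

  IsCopy : V → Set
  IsCopy (copy _ _)   = ⊤
  IsCopy (gadget _ _) = ⊥

  isCopy? : Decidable IsCopy
  isCopy? (copy _ _)   = yes tt
  isCopy? (gadget _ _) = no λ ()

  vertexOf : (v : V) → IsCopy v → Fin (n H)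
  vertexOf (copy _ x) _ = x

  positionOf : (v : V) → ¬ IsCopy v → Fin s
  positionOf (copy _ _)   ¬c = ⊥-elim (¬c tt)
  positionOf (gadget _ j) _  = j

  copies-adjacent : ∀ u v cu cv → E u v → Adj H (vertexOf u cu) (vertexOf v cv)
  copies-adjacent (copy _ _) (copy _ _) _ _ (_ , a) = a

  gadgets-separated : ∀ u v gu gv → E u v → positionOf u gu ≢ positionOf v gv
  gadgets-separated (copy _ _)   _            gu _  _ = ⊥-elim (gu tt)
  gadgets-separated (gadget _ _) (copy _ _)   _  gv _ = ⊥-elim (gv tt)
  gadgets-separated (gadget _ _) (gadget _ _) _  _  (_ , j≢j′) = j≢j′

  noTwoGadgets : ∀ w u v → IsCopy w → ¬ IsCopy u → ¬ IsCopy v → E w u → E w v → ¬ E u v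
  noTwoGadgets (copy _ _) (copy _ _)   _            _ ¬cu _   _ _ _ = ¬cu tt
  noTwoGadgets (copy _ _) (gadget _ _) (copy _ _)   _ _   ¬cv _ _ _ = ¬cv tt
  noTwoGadgets (copy i x) (gadget γ j) (gadget .γ j′) _ _ _ (_ , sole) (γj′≡i , _) (refl , j≢j′) =
    j≢j′ (sym (sole j′ γj′≡i))

  noLargeClique : (f : Fin (suc s) → V) → IsClique E f → ⊥
  noLargeClique f clique with any? (λ j → isCopy? (f j))
  -- Only gadget vertices: their s+1 positions would be distinct.
  ... | no noCopy = 1+n≰n (injective⇒≤ (separated⇒injective position separated))
    where
    position : Fin (suc s) → Fin s
    position j = positionOf (f j) (λ c → noCopy (j , c))
    separated : ∀ i j → i ≢ j → position i ≢ position j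
    separated i j i≢j = gadgets-separated (f i) (f j) _ _ (clique i j i≢j)
  -- A copy vertex: all other vertices but one lie in its copy and form an
  -- s-clique of H.
  ... | yes (j₀ , copy₀) = noCliqueH (vertex , clique⇒injective {E = Adj H} (Graph.irr H) vertex adj , adj)
    where
    ≢j₀ : ∀ {j} → ¬ IsCopy (f j) → j ≢ j₀
    ≢j₀ ¬c refl = ¬c copy₀
    exceptional : Σ (Fin (suc s)) λ r → ∀ j → j ≢ r → IsCopy (f j)
    exceptional with any? (λ j → ¬? (isCopy? (f j)))
    ... | no noGadget = zero , λ j _ → decidable-stable (isCopy? (f j)) (λ ¬c → noGadget (j , ¬c))
    ... | yes (r , ¬cr) = r , λ j j≢r → decidable-stable (isCopy? (f j)) λ ¬cj →
          noTwoGadgets (f j₀) (f r) (f j) copy₀ ¬cr ¬cj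
            (clique j₀ r (≢j₀ ¬cr ∘ sym)) (clique j₀ j (≢j₀ ¬cj ∘ sym)) (clique r j (j≢r ∘ sym))
    r : Fin (suc s)
    r = proj₁ exceptional
    vertex : Fin s → Fin (n H)
    vertex i = vertexOf (f (punchIn r i)) (proj₂ exceptional _ (FinP.punchInᵢ≢i r i))
    adj : IsClique (Adj H) vertex
    adj i i′ i≢i′ = copies-adjacent _ _ _ _ (clique _ _ (i≢i′ ∘ punchIn-injective r i i′))

  gadgetClique : (γ : Tuple) → IsClique E (gadget γ)
  gadgetClique γ i j i≢j = refl , i≢j

  colourSum : V → Fin (suc t) ⊎ Fin s
  colourSum (copy _ x)   = inj₁ (proj₁ colH x)
  colourSum (gadget _ j) = inj₂ j

  colour : V → Fin (suc t + s)
  colour = join (suc t) s ∘ colourSum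

  -- join is injective, splitAt being its left inverse.
  colour-proper : IsProperColouring E colour
  colour-proper u v a e = different u v a (trans (sym (splitAt-join (suc t) s (colourSum u)))
                            (trans (cong (splitAt (suc t)) e) (splitAt-join (suc t) s (colourSum v))))
    where
    different : ∀ u v → E u v → colourSum u ≢ colourSum v
    different (copy _ x)   (copy _ y)   (_ , a)    e = proj₂ colH x y a (inj₁-injective e)
    different (copy _ _)   (gadget _ _) _          ()
    different (gadget _ _) (copy _ _)   _          ()
    different (gadget _ _) (gadget _ _) (_ , j≢j′) e = j≢j′ (inj₂-injective e)

  -- No proper colouring with D = s + t colours: by pigeonhole s copies share
  -- a colour pattern, and the gadget on them forces s further colours.
  noColouring : (col : V → Fin D) → IsProperColouring E col → ⊥
  noColouring col proper = 1+n≰n (lowH t (h′ , h′-proper))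
    where
    colourPattern : Fin M → Fin P
    colourPattern i = funToFin (λ x → col (copy i x))
    open Monochromatic (pigeonhole (suc k) P colourPattern (n<1+n _)) renaming (point to g)
    γ : Tuple
    γ = funToFin g
    attached : ∀ j → SoleEntry γ j (g j)
    attached j = finToFun-funToFin g j ,
                 λ j′ e → point-inj (trans (sym (finToFun-funToFin g j′)) e)
    samePattern : ∀ j x → col (copy (g j) x) ≡ col (copy (g zero) x)
    samePattern j x = begin
      col (copy (g j) x)                   ≡⟨ finToFun-funToFin _ x ⟨
      finToFun (colourPattern (g j)) x     ≡⟨ cong (λ σ → finToFun σ x) (same j) ⟩
      finToFun (colourPattern (g zero)) x  ≡⟨ finToFun-funToFin _ x ⟩
      col (copy (g zero) x)                ∎
      where open ≡-Reasoning
    h : Fin (n H) → Fin D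
    h x = col (copy (g zero) x)
    gadgetColour : Fin s → Fin D
    gadgetColour j = col (gadget γ j)
    gadgetColour-inj : Injective _≡_ _≡_ gadgetColour
    gadgetColour-inj = separated⇒injective gadgetColour λ i j i≢j → proper _ _ (refl , i≢j)
    avoids : ∀ x j → h x ≢ gadgetColour j
    avoids x j e = proper (copy (g j) x) (gadget γ j) (attached j) (trans (samePattern j x) e)
    compressed : Σ (Fin (n H) → Fin t) λ h′ → ∀ x y → h′ x ≡ h′ y → h x ≡ h y
    compressed = compress s t h gadgetColour gadgetColour-inj avoids
    h′ : Fin (n H) → Fin t
    h′ = proj₁ compressed
    h′-proper : ∀ x y → Adj H x y → h′ x ≢ h′ y
    h′-proper x y a e = proper (copy (g zero) x) (copy (g zero) y) (refl , a) (proj₂ compressed x y e)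

  -- χ ≥ (t+1) + s: fewer colours would fit into D colours.
  atLeast : ∀ d (col : V → Fin d) → IsProperColouring E col → suc t + s ≤ d
  atLeast d col proper with suc t + s ≤? d
  ... | yes enough = enough
  ... | no tooFew = ⊥-elim (noColouring (λ v → inject≤ (col v) d≤D)
                      (λ u v a e → proper u v a (inject≤-injective d≤D d≤D _ _ e)))
    where
    d≤D : d ≤ D
    d≤D = subst (d ≤_) (+-comm t s) (≤-pred (≰⇒> tooFew))

  label : Fin (M * n H + M ^ s * s) ↔ V
  label = ↔-trans +↔⊎ (*↔× ⊎-↔ *↔×)

  open Relabel label E E-sym E-irr public

  graph-magical : Magical graph
  graph-magical = magical <₁-STO <₂-STO magic

  graph-ω : CliqueNumber graph s
  graph-ω = hasClique (gadget γ₀) (gadgetClique γ₀) , noClique noLargeClique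
    where
    γ₀ : Tuple
    γ₀ = funToFin (λ (_ : Fin s) → zero)

  graph-χ : ChromaticNumber graph (suc t + s)
  graph-χ = colourable colour colour-proper ,
            λ d col → atLeast d (proj₁ (colouring col)) (proj₂ (colouring col))

-- One step: ω grows by one and χ grows by the new clique number.  The case
-- χ(H) = 0 is impossible as H has a vertex.
step : (H : Graph) (k : ℕ) {c : ℕ} → Magical H → CliqueNumber H (suc k) → ChromaticNumber H c →
       Σ Graph λ G → Magical G × CliqueNumber G (suc (suc k)) × ChromaticNumber G (c + suc (suc k))
step H k {zero}  _    ((clique , _) , _) ((col , _) , _) = ⊥-elim (¬Fin0 (col (clique zero)))
step H k {suc t} magH (_ , noCliqueH)   (colH , lowH)   =
  graph , graph-magical , graph-ω , graph-χ
  where open Step H k t magH noCliqueH colH lowH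

K₁ : Graph
K₁ = record { n = 1 ; Adj = λ _ _ → ⊥ ; sym = λ () ; irr = λ () }

K₁-magical : Magical K₁
K₁-magical = (_ , <-STO) , (_ , <-STO) , λ _ _ _ _ _ ()

K₁-ω : CliqueNumber K₁ 1
K₁-ω = ((λ i → i) , (λ e → e) , λ { zero zero 0≢0 → 0≢0 refl })
     , λ { (_ , _ , clique) → clique zero (suc zero) (λ ()) }

K₁-χ : ChromaticNumber K₁ 1
K₁-χ = ((λ _ → zero) , λ _ _ ()) , atLeastOne
  where
  atLeastOne : ∀ d → Colourable K₁ d → 1 ≤ d
  atLeastOne zero    (col , _) = ⊥-elim (¬Fin0 (col zero))
  atLeastOne (suc d) _         = s≤s z≤n

pascal₂ : ∀ n → n C 2 + n ≡ suc n C 2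
pascal₂ n = begin
  n C 2 + n       ≡⟨ +-comm (n C 2) n ⟩
  n + n C 2       ≡⟨ cong (_+ n C 2) (nC1≡n n) ⟨
  n C 1 + n C 2   ≡⟨ nCk+nC[k+1]≡[n+1]C[k+1] n 1 ⟩
  suc n C 2       ∎
  where open ≡-Reasoning

tower : ∀ k → Σ Graph λ G → Magical G × CliqueNumber G (suc k) × ChromaticNumber G (suc (suc k) C 2)
tower zero = K₁ , K₁-magical , K₁-ω , K₁-χ
tower (suc k) with tower k
... | H , magH , ωH , χH with step H k magH ωH χH
...   | G , magG , ωG , χG = G , magG , ωG , subst (ChromaticNumber G) (pascal₂ (suc (suc k))) χG

-- The statement holds for k = 1 as well (K₁).
theorem7 : (k : ℕ) → 2 ≤ k →
    Σ Graph λ G → Magical G × CliqueNumber G k × ChromaticNumber G ((suc k) C 2)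
theorem7 zero    ()
theorem7 (suc k) _ = tower k
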